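{- If $F$ is a partially marked forest, then $\iota_{\rm g}(F)\le \iota_{\rm g}'(F)$.
   Context: All graphs are finite and simple; $N[x]$ is the closed neighborhood of $x$. A partially marked graph $G|A$ is a graph $G$ with a set $A\subseteq V(G)$ of marked vertices such that $G-A$ has no isolated vertices. The isolation game on $G|A$: Dominator and Staller alternately choose vertices. A marked set $M$ is maintained, initially $M=A$. A vertex $x$ may be chosen only if $N[x]\not\subseteq M$. When $x$ is chosen, $M$ is replaced by $M\cup N[x]\cup U$, where $U$ is the set of isolated vertices of $G-(M\cup N[x])$. The game ends when every vertex is marked. Dominator wants to minimize the number of chosen vertices, Staller to maximize it. $\iota_{\rm g}(G|A)$ (resp. $\iota_{\rm g}'(G|A)$) is the number of chosen vertices under optimal play when Dominator (resp. Staller) moves first. A partially marked forest is a partially marked graph whose underlying graph is a forest (with $A=\emptyset$ this is the ordinary isolation game on a forest, i.e. the game that ends when the unchosen-and-undominated vertices form an independent set). -}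

module Defs where

open import Data.Nat using (ℕ; zero; suc; _≤_; _⊓_; _⊔_)
open import Data.Fin using (Fin; _≟_)
open import Relation.Nullary.Decidable using (does)
open import Data.Bool using (Bool; true; false; not; _∨_; _∧_; if_then_else_)
open import Data.List using (List; []; _∷_; [_]; _++_; length; map; foldr; allFin; filterᵇ)
open import Data.Bool.ListAction using (all; any)
open import Data.List.Relation.Unary.Linked using (Linked)
open import Data.List.Relation.Unary.Unique.Propositional using (Unique)
open import Data.Product using (∃; _×_; Σ)
open import Relation.Binary.PropositionalEquality using (_≡_)
open import Relation.Nullary using (¬_)

record Graph (n : ℕ) : Set where
  field
    adj   : Fin n → Fin n → Bool
    sym   : ∀ u v → adj u v ≡ adj v u
    irrefl : ∀ v → adj v v ≡ false
open Graph public

module _ {n : ℕ} (G : Graph n) where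

  Adj : Fin n → Fin n → Set
  Adj u v = adj G u v ≡ true

  HasCycle : Set
  HasCycle = ∃ λ (v : Fin n) → ∃ λ (vs : List (Fin n)) →
    (2 ≤ length vs) × Unique (v ∷ vs) × Linked Adj (v ∷ vs ++ [ v ])

  IsForest : Set
  IsForest = ¬ HasCycle

  VSet : Set
  VSet = Fin n → Bool

  closedN : Fin n → VSet
  closedN x v = adj G x v ∨ does (x ≟ v)

  -- G - A has no isolated vertices: every unmarked vertex has an unmarked neighbour.
  PartiallyMarked : VSet → Set
  PartiallyMarked A = ∀ v → A v ≡ false → ∃ λ u → Adj v u × A u ≡ false

  allMarked : VSet → Bool
  allMarked M = all M (allFin n)

  legal : VSet → Fin n → Bool
  legal M x = any (λ v → closedN x v ∧ not (M v)) (allFin n)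

  -- M ↦ M ∪ N[x] ∪ U, U = isolated vertices of G - (M ∪ N[x])
  play : VSet → Fin n → VSet
  play M x v = M₁ v ∨ all (λ u → not (adj G v u) ∨ M₁ u) (allFin n)
    where
    M₁ : VSet
    M₁ w = M w ∨ closedN x w

  minL : List ℕ → ℕ
  minL []       = 0
  minL (a ∷ as) = foldr _⊓_ a as

  maxL : List ℕ → ℕ
  maxL = foldr _⊔_ 0

  -- Value of the game from marked set M under optimal play, with the
  -- given player to move (true = Dominator, false = Staller).
  -- The fuel bounds the number of remaining moves; every legal move marks
  -- at least one new vertex, so fuel n is always sufficient.
  value : ℕ → Bool → VSet → ℕ
  value zero    _ _ = 0
  value (suc k) d M =
    if allMarked M then 0
    else (if d then minL else maxL)
           (map (λ x → suc (value k (not d) (play M x))) (filterᵇ (legal M) (allFin n)))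

  ιg : VSet → ℕ
  ιg A = value n true A

  ιg' : VSet → ℕ
  ιg' A = value n false A

{-# OPTIONS --safe #-}
-- Imagination strategy. Say that I has an extra edge over R if I ⊆ R and some edge ℓs,
-- unmarked in I, is sealed in R: no move legal in R touches ℓ or s. Then, whoever moves first,
-- the game from I lasts at least one move longer than the game from R: the player who wants a
-- long game copies optimal play from R, and those moves leave ℓs unmarked in I. The delicate
-- case is a Dominator move in I that is illegal in R. It marks nothing outside R, so by the
-- continuation principle (marking more vertices never lengthens the game) it is handled by the
-- theorem for R; the theorem and the two extra-edge inequalities are therefore proved by one
-- simultaneous induction.
--
-- The theorem follows once Dominator can always open with a move p such that M has an extra
-- edge over play M p, since then ι_g(M) ≤ 1 + ι_g'(play M p) ≤ ι_g'(M). In a forest, take a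
-- path ℓ s x₂ … with ℓ and s unmarked, and let p = x₂ (or p = s if the path is just ℓs). If ℓs
-- is not sealed after p, some vertex w near ℓs and a neighbour u of w are unmarked and outside
-- N[p]; as the forest has no cycles, they give a longer path of the same kind. Paths have at
-- most n vertices, so this search ends with a sealing move.
--
-- Everything is proved for arbitrary fuel k, so it never matters whether n is enough fuel.
module Submission where

open import Defs hiding (sym)
open import Data.Bool using (Bool; true; false; not; _∨_; _∧_; if_then_else_)
  renaming (_≟_ to _≟ᵇ_)
open import Data.Bool.ListAction using (all; any)
open import Data.Bool.Properties
  using ( T-≡; ¬-not; not-¬; not-injective; if-cong; ∨-zeroʳ; ∨-identityʳ
        ; ∨-conicalˡ; ∨-conicalʳ; ∧-conicalˡ; ∧-conicalʳ )
open import Data.Empty using (⊥-elim)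
open import Data.Fin using (Fin; _≟_)
import Data.Fin as Fin
open import Data.Fin.Properties using (injective⇒≤; ¬∀⟶∃¬)
open import Data.List using (List; []; _∷_; _++_; length; lookup; map; filterᵇ; allFin)
open import Data.List.Properties using (foldr-preservesᵇ; foldr-preservesᵒ)
open import Data.List.Membership.Propositional using (_∈_; _∉_; find; lose)
open import Data.List.Membership.Propositional.Properties
  using (∈-filter⁺; ∈-filter⁻; ∈-map⁺; ∈-map⁻; ∈-allFin; ∈-∃++; ∈-lookup; ∈-insert)
open import Data.List.Relation.Unary.All as All using ([]; _∷_)
open import Data.List.Relation.Unary.All.Properties using (all⁺; all⁻; ¬Any⇒All¬; ++⁻ˡ)
open import Data.List.Relation.Unary.AllPairs using ([]; _∷_)
open import Data.List.Relation.Unary.Any as Any using (here; there)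
open import Data.List.Relation.Unary.Any.Properties using (any⁺; any⁻)
open import Data.List.Relation.Unary.Linked as Linked using (Linked; [-]; _∷_)
open import Data.List.Relation.Unary.Unique.Propositional using (Unique)
open import Data.Nat using (ℕ; zero; suc; _≤_; _<_; _+_; _⊓_; _⊔_; z≤n; s≤s; z<s)
open import Data.Nat.Properties
  using ( ≤-refl; ≤-trans; ≤-reflexive; n≤1+n; m≤m+n; +-suc; +-monoʳ-≤; ≤⇒≯; module ≤-Reasoning
        ; ⊓-sel; ⊔-sel; ⊔-identityʳ; m≤n⇒m⊓o≤n; m≤n⇒o⊓m≤n; m≤n⇒m≤n⊔o; m≤n⇒m≤o⊔n )
open import Data.Product using (Σ; ∃; ∃₂; _×_; _,_; proj₂; map₂)
open import Data.Sum using (_⊎_; inj₁; inj₂; [_,_]; [_,_]′)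
import Data.Sum as Sum
open import Data.Unit using (⊤; tt)
open import Function using (_∘_; id; Equivalence)
open import Relation.Binary.PropositionalEquality
  using (_≡_; _≢_; refl; sym; trans; cong; cong₂; subst; ≢-sym)
open import Relation.Nullary using (¬_; yes; no; contradiction)
open import Relation.Nullary.Decidable using (T?)

∨-true⁺ : ∀ a {b} → a ≡ true ⊎ b ≡ true → a ∨ b ≡ true
∨-true⁺ _ (inj₁ refl) = refl
∨-true⁺ a (inj₂ refl) = ∨-zeroʳ a

∨-true⁻ : ∀ a {b} → a ∨ b ≡ true → a ≡ true ⊎ b ≡ true
∨-true⁻ true  _ = inj₁ refl
∨-true⁻ false h = inj₂ h

not∨-true⁺ : ∀ a {b} → (a ≡ true → b ≡ true) → not a ∨ b ≡ true
not∨-true⁺ true  h = h refl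
not∨-true⁺ false _ = refl

not∨-true⁻ : ∀ a {b} → not a ∨ b ≡ true → a ≡ true → b ≡ true
not∨-true⁻ true h refl = h

not∨-false⁻ : ∀ a {b} → not a ∨ b ≡ false → a ≡ true × b ≡ false
not∨-false⁻ true h = refl , h

distinguishes : ∀ {A : Set} (f : A → Bool) {a b} → f a ≡ true → f b ≡ false → b ≢ a
distinguishes f fa fb refl = not-¬ fa fb

module _ {n : ℕ} (p : Fin n → Bool) where

  all-allFin⁻ : all p (allFin n) ≡ true → ∀ x → p x ≡ true
  all-allFin⁻ h x = Equivalence.to T-≡
    (All.lookup (all⁺ p (allFin n) (Equivalence.from T-≡ h)) (∈-allFin x))

  all-allFin⁺ : (∀ x → p x ≡ true) → all p (allFin n) ≡ true
  all-allFin⁺ h = Equivalence.to T-≡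
    (all⁻ p {xs = allFin n} (All.tabulate λ {x} _ → Equivalence.from T-≡ (h x)))

  all-allFin-false⁻ : all p (allFin n) ≡ false → ∃ λ x → p x ≡ false
  all-allFin-false⁻ h
    with x , px≢true ← ¬∀⟶∃¬ n (λ x → p x ≡ true) (λ x → p x ≟ᵇ true)
                              (λ all-true → not-¬ (all-allFin⁺ all-true) h)
    = x , ¬-not px≢true

  any-allFin⁺ : ∀ x → p x ≡ true → any p (allFin n) ≡ true
  any-allFin⁺ x px = Equivalence.to T-≡ (any⁺ p (lose (∈-allFin x) (Equivalence.from T-≡ px)))

  any-allFin⁻ : any p (allFin n) ≡ true → ∃ λ x → p x ≡ true
  any-allFin⁻ h with x , _ , px ← find (any⁻ p (allFin n) (Equivalence.from T-≡ h)) =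
    x , Equivalence.to T-≡ px

lookup-injective : ∀ {A : Set} {xs : List A} → Unique xs →
                   ∀ {i j} → lookup xs i ≡ lookup xs j → i ≡ j
lookup-injective (_  ∷ _)  {Fin.zero}  {Fin.zero}  _  = refl
lookup-injective (x∉ ∷ _)  {Fin.zero}  {Fin.suc j} eq = contradiction eq (All.lookup x∉ (∈-lookup j))
lookup-injective (x∉ ∷ _)  {Fin.suc i} {Fin.zero}  eq =
  contradiction (sym eq) (All.lookup x∉ (∈-lookup i))
lookup-injective (_  ∷ xs) {Fin.suc i} {Fin.suc j} eq = cong Fin.suc (lookup-injective xs eq)

unique-rotate : ∀ {A : Set} (zs : List A) {b ys} → Unique (zs ++ b ∷ ys) → Unique (b ∷ zs)
unique-rotate []       (_ ∷ _) = [] ∷ []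
unique-rotate (z ∷ zs) (z∉ ∷ u) with b∉zs ∷ uzs ← unique-rotate zs u =
  (≢-sym (All.lookup z∉ (∈-insert zs)) ∷ b∉zs) ∷ (++⁻ˡ zs z∉ ∷ uzs)

linked-prefix : ∀ {A : Set} {R : A → A → Set} (zs : List A) {b ys} →
                Linked R (zs ++ b ∷ ys) → Linked R (zs ++ b ∷ [])
linked-prefix []           _       = [-]
linked-prefix (_ ∷ [])     (r ∷ _) = r ∷ [-]
linked-prefix (_ ∷ z ∷ zs) (r ∷ l) = r ∷ linked-prefix (z ∷ zs) l

module _ {n : ℕ} (G : Graph n) where

  Adj-sym : ∀ {u v} → Adj G u v → Adj G v u
  Adj-sym {u} {v} uv = trans (Graph.sym G v u) uv

  Adj-irrefl : ∀ {u v} → Adj G u v → u ≢ v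
  Adj-irrefl {u} uu refl = not-¬ uu (Graph.irrefl G u)

  infix 4 _⊆_
  _⊆_ : VSet G → VSet G → Set
  A ⊆ B = ∀ v → A v ≡ true → B v ≡ true

  ⊆-false : ∀ {A B v} → A ⊆ B → B v ≡ false → A v ≡ false
  ⊆-false {v = v} A⊆B v∉B = ¬-not λ v∈A → not-¬ (A⊆B v v∈A) v∉B

  infixr 6 _∪_
  _∪_ : VSet G → VSet G → VSet G
  (A ∪ B) v = A v ∨ B v

  ∪-monoˡ : ∀ {A B} C → A ⊆ B → A ∪ C ⊆ B ∪ C
  ∪-monoˡ {A} _ A⊆B v h =
    [ (λ v∈A → ∨-true⁺ _ (inj₁ (A⊆B v v∈A))) , (λ v∈C → ∨-true⁺ _ (inj₂ v∈C)) ] (∨-true⁻ (A v) h)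

  ∪-least : ∀ {A B C} → A ⊆ C → B ⊆ C → A ∪ B ⊆ C
  ∪-least {A} A⊆C B⊆C v h = [ A⊆C v , B⊆C v ] (∨-true⁻ (A v) h)

  N[_] : Fin n → VSet G
  N[ x ] = closedN G x

  x∈N[x] : ∀ x → N[ x ] x ≡ true
  x∈N[x] x with x ≟ x
  ... | yes _   = ∨-zeroʳ (adj G x x)
  ... | no x≢x = contradiction refl x≢x

  Adj⇒∈N : ∀ {x v} → Adj G x v → N[ x ] v ≡ true
  Adj⇒∈N xv = ∨-true⁺ _ (inj₁ xv)

  ∈N⁻ : ∀ {x v} → N[ x ] v ≡ true → Adj G x v ⊎ x ≡ v
  ∈N⁻ {x} {v} h with x ≟ v
  ... | yes x≡v = inj₂ x≡v
  ... | no  _   = inj₁ (trans (sym (∨-identityʳ (adj G x v))) h)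

  NeighboursIn : VSet G → Fin n → Set
  NeighboursIn A v = ∀ u → Adj G v u → A u ≡ true

  neighboursIn⁺ : ∀ {A v} → NeighboursIn A v →
                  all (λ u → not (adj G v u) ∨ A u) (allFin n) ≡ true
  neighboursIn⁺ {v = v} h = all-allFin⁺ _ λ u → not∨-true⁺ (adj G v u) (h u)

  neighboursIn⁻ : ∀ {A v} → all (λ u → not (adj G v u) ∨ A u) (allFin n) ≡ true →
                  NeighboursIn A v
  neighboursIn⁻ {v = v} h u = not∨-true⁻ (adj G v u) (all-allFin⁻ _ h u)

  play-true⁺ : ∀ M x {v} → (M ∪ N[ x ]) v ≡ true ⊎ NeighboursIn (M ∪ N[ x ]) v →
               play G M x v ≡ true
  play-true⁺ M x {v} h = ∨-true⁺ ((M ∪ N[ x ]) v) (Sum.map₂ neighboursIn⁺ h)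

  play-true⁻ : ∀ M x {v} → play G M x v ≡ true →
               (M ∪ N[ x ]) v ≡ true ⊎ NeighboursIn (M ∪ N[ x ]) v
  play-true⁻ M x {v} h = Sum.map₂ neighboursIn⁻ (∨-true⁻ ((M ∪ N[ x ]) v) h)

  play-false⁻ : ∀ M x {v} → play G M x v ≡ false →
                (M ∪ N[ x ]) v ≡ false × ∃ λ u → Adj G v u × (M ∪ N[ x ]) u ≡ false
  play-false⁻ M x {v} h with u , vu ← all-allFin-false⁻ _ (∨-conicalʳ ((M ∪ N[ x ]) v) _ h) =
    ∨-conicalˡ ((M ∪ N[ x ]) v) _ h , u , not∨-false⁻ (adj G v u) vu

  play-false⁺ : ∀ M x {v u} → (M ∪ N[ x ]) v ≡ false → Adj G v u → (M ∪ N[ x ]) u ≡ false →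
                play G M x v ≡ false
  play-false⁺ M x v∉ vu u∉ = ¬-not λ v∈ →
    [ (λ v∈′ → not-¬ v∈′ v∉) , (λ nbrs → not-¬ (nbrs _ vu) u∉) ] (play-true⁻ M x v∈)

  ⊆-play : ∀ M x → M ⊆ play G M x
  ⊆-play M x v v∈M = play-true⁺ M x (inj₁ (∨-true⁺ (M v) (inj₁ v∈M)))

  play-partiallyMarked : ∀ M x → PartiallyMarked G (play G M x)
  play-partiallyMarked M x v v∉ with v∉′ , u , vu , u∉ ← play-false⁻ M x v∉ =
    u , vu , play-false⁺ M x u∉ (Adj-sym vu) v∉′

  play-monotone : ∀ {M M′} x → M ⊆ M′ → play G M x ⊆ play G M′ x
  play-monotone {M} {M′} x M⊆M′ v h = play-true⁺ M′ x
    (Sum.map (M∪N⊆M′∪N v) (λ nbrs u vu → M∪N⊆M′∪N u (nbrs u vu)) (play-true⁻ M x h))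
    where
    M∪N⊆M′∪N : M ∪ N[ x ] ⊆ M′ ∪ N[ x ]
    M∪N⊆M′∪N = ∪-monoˡ N[ x ] M⊆M′

  play-least : ∀ {M M′} x → PartiallyMarked G M′ → M ⊆ M′ → N[ x ] ⊆ M′ → play G M x ⊆ M′
  play-least {M} {M′} x pm M⊆M′ N⊆M′ v v∈ = ¬-not λ v∉M′ →
    let u , vu , u∉M′ = pm v v∉M′ in
    not-¬ v∈ (play-false⁺ M x (⊆-false M∪N⊆M′ v∉M′) vu (⊆-false M∪N⊆M′ u∉M′))
    where
    M∪N⊆M′ : M ∪ N[ x ] ⊆ M′
    M∪N⊆M′ = ∪-least M⊆M′ N⊆M′

  legal⁺ : ∀ {M x v} → N[ x ] v ≡ true → M v ≡ false → legal G M x ≡ true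
  legal⁺ {v = v} xv v∉M = any-allFin⁺ _ v (cong₂ _∧_ xv (cong not v∉M))

  legal⁻ : ∀ {M x} → legal G M x ≡ true → ∃ λ v → N[ x ] v ≡ true × M v ≡ false
  legal⁻ h with v , eq ← any-allFin⁻ _ h =
    v , ∧-conicalˡ _ _ eq , not-injective (∧-conicalʳ _ _ eq)

  legal-self : ∀ {M v} → M v ≡ false → legal G M v ≡ true
  legal-self v∉M = legal⁺ (x∈N[x] _) v∉M

  illegal⇒N⊆ : ∀ {M x} → legal G M x ≡ false → N[ x ] ⊆ M
  illegal⇒N⊆ h v xv = ¬-not λ v∉M → not-¬ (legal⁺ xv v∉M) h

  legal-antitone : ∀ {M M′ x} → M ⊆ M′ → legal G M′ x ≡ true → legal G M x ≡ true
  legal-antitone M⊆M′ h with v , xv , v∉M′ ← legal⁻ h = legal⁺ xv (⊆-false M⊆M′ v∉M′)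

  allMarked-false : ∀ {M v} → M v ≡ false → allMarked G M ≡ false
  allMarked-false {M} {v} v∉M = ¬-not λ full → not-¬ (all-allFin⁻ M full v) v∉M

  allMarked-or-unmarked : ∀ M → allMarked G M ≡ true ⊎ ∃ λ v → M v ≡ false
  allMarked-or-unmarked M with allMarked G M in full
  ... | true  = inj₁ refl
  ... | false = inj₂ (all-allFin-false⁻ M full)

  minL-≤ : ∀ {x} xs → x ∈ xs → minL G xs ≤ x
  minL-≤ {x} (a ∷ as) x∈ = foldr-preservesᵒ ⊓-≤ a as (head-or-tail x∈)
    where
    ⊓-≤ : ∀ u w → u ≤ x ⊎ w ≤ x → u ⊓ w ≤ x
    ⊓-≤ u w = [ m≤n⇒m⊓o≤n w , m≤n⇒o⊓m≤n u ]
    head-or-tail : x ∈ a ∷ as → a ≤ x ⊎ Any.Any (_≤ x) as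
    head-or-tail (here x≡a)   = inj₁ (≤-reflexive (sym x≡a))
    head-or-tail (there x∈as) = inj₂ (Any.map (≤-reflexive ∘ sym) x∈as)

  minL-∈ : ∀ {x} xs → x ∈ xs → minL G xs ∈ xs
  minL-∈ (a ∷ as) _ = foldr-preservesᵇ ⊓-closed (here refl) (All.tabulate there)
    where
    ⊓-closed : ∀ {u w} → u ∈ a ∷ as → w ∈ a ∷ as → u ⊓ w ∈ a ∷ as
    ⊓-closed {u} {w} u∈ w∈ with ⊓-sel u w
    ... | inj₁ u⊓w≡u rewrite u⊓w≡u = u∈
    ... | inj₂ u⊓w≡w rewrite u⊓w≡w = w∈

  maxL-≥ : ∀ {x} xs → x ∈ xs → x ≤ maxL G xs
  maxL-≥ {x} xs x∈ = foldr-preservesᵒ ≤-⊔ 0 xs (inj₂ (Any.map ≤-reflexive x∈))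
    where
    ≤-⊔ : ∀ u w → x ≤ u ⊎ x ≤ w → x ≤ u ⊔ w
    ≤-⊔ u w = [ m≤n⇒m≤n⊔o w , m≤n⇒m≤o⊔n u ]

  maxL-∈ : ∀ {x} xs → x ∈ xs → maxL G xs ∈ xs
  maxL-∈ (a ∷ [])     _ = here (⊔-identityʳ a)
  maxL-∈ (a ∷ b ∷ bs) _ =
    [ here , (λ eq → there (subst (_∈ b ∷ bs) (sym eq) (maxL-∈ (b ∷ bs) (here refl)))) ]′
      (⊔-sel a (maxL G (b ∷ bs)))

  legalMoves : VSet G → List (Fin n)
  legalMoves M = filterᵇ (legal G M) (allFin n)

  ∈-legalMoves⁺ : ∀ {M x} → legal G M x ≡ true → x ∈ legalMoves M
  ∈-legalMoves⁺ {M} {x} h = ∈-filter⁺ (T? ∘ legal G M) (∈-allFin x) (Equivalence.from T-≡ h)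

  ∈-legalMoves⁻ : ∀ {M x} → x ∈ legalMoves M → legal G M x ≡ true
  ∈-legalMoves⁻ {M} x∈ =
    Equivalence.to T-≡ (proj₂ (∈-filter⁻ (T? ∘ legal G M) {xs = allFin n} x∈))

  value-allMarked : ∀ k d {M} → allMarked G M ≡ true → value G k d M ≡ 0
  value-allMarked zero    _ _    = refl
  value-allMarked (suc k) _ full = if-cong full

  value-unfinished : ∀ k d {M} → allMarked G M ≡ false →
    value G (suc k) d M ≡
    (if d then minL G else maxL G) (map (λ x → suc (value G k (not d) (play G M x))) (legalMoves M))
  value-unfinished _ _ unfinished = if-cong unfinished

  module _ (k : ℕ) {M : VSet G} {v : Fin n} (v∉M : M v ≡ false) where

    value-dominator-≤ : ∀ {x} → legal G M x ≡ true →
                        value G (suc k) true M ≤ suc (value G k false (play G M x))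
    value-dominator-≤ lx = ≤-trans (≤-reflexive (value-unfinished k true (allMarked-false v∉M)))
                                   (minL-≤ _ (∈-map⁺ _ (∈-legalMoves⁺ lx)))

    value-staller-≥ : ∀ {x} → legal G M x ≡ true →
                      suc (value G k true (play G M x)) ≤ value G (suc k) false M
    value-staller-≥ lx = ≤-trans (maxL-≥ _ (∈-map⁺ _ (∈-legalMoves⁺ lx)))
                                 (≤-reflexive (sym (value-unfinished k false (allMarked-false v∉M))))

    value-dominator-optimal : ∃ λ x → legal G M x ≡ true ×
                              value G (suc k) true M ≡ suc (value G k false (play G M x))
    value-dominator-optimal
      with x , x∈ , eq ← ∈-map⁻ _ (minL-∈ _ (∈-map⁺ (λ y → suc (value G k false (play G M y)))
                                                     (∈-legalMoves⁺ (legal-self v∉M))))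
      = x , ∈-legalMoves⁻ x∈ , trans (value-unfinished k true (allMarked-false v∉M)) eq

    value-staller-optimal : ∃ λ x → legal G M x ≡ true ×
                            value G (suc k) false M ≡ suc (value G k true (play G M x))
    value-staller-optimal
      with x , x∈ , eq ← ∈-map⁻ _ (maxL-∈ _ (∈-map⁺ (λ y → suc (value G k true (play G M y)))
                                                     (∈-legalMoves⁺ (legal-self v∉M))))
      = x , ∈-legalMoves⁻ x∈ , trans (value-unfinished k false (allMarked-false v∉M)) eq

    value-positive : ∀ d → 0 < value G (suc k) d M
    value-positive true  with _ , _ , eq ← value-dominator-optimal rewrite eq = z<s
    value-positive false with _ , _ , eq ← value-staller-optimal   rewrite eq = z<s

  value-antitone : ∀ k d {M M′} → PartiallyMarked G M′ → M ⊆ M′ → value G k d M′ ≤ value G k d M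
  value-antitone zero    _ _ _ = z≤n
  value-antitone (suc k) d {M} {M′} pm M⊆M′ with allMarked-or-unmarked M′
  ... | inj₁ full rewrite value-allMarked (suc k) d full = z≤n
  ... | inj₂ (v , v∉M′) = antitone d
    where
    open ≤-Reasoning

    v∉M : M v ≡ false
    v∉M = ⊆-false M⊆M′ v∉M′

    answer : ∀ x → value G (suc k) true M′ ≤ suc (value G k false (play G M x))
    answer x with legal G M′ x in lx
    ... | true = begin
      value G (suc k) true M′             ≤⟨ value-dominator-≤ k v∉M′ lx ⟩
      suc (value G k false (play G M′ x)) ≤⟨ s≤s (value-antitone k false
                                                   (play-partiallyMarked M′ x) (play-monotone x M⊆M′)) ⟩
      suc (value G k false (play G M x))  ∎
    ... | false = begin
      value G (suc k) true M′             ≤⟨ value-dominator-≤ k v∉M′ (legal-self v∉M′) ⟩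
      suc (value G k false (play G M′ v)) ≤⟨ s≤s (value-antitone k false
                                                   (play-partiallyMarked M′ v) (⊆-play M′ v)) ⟩
      suc (value G k false M′)            ≤⟨ s≤s (value-antitone k false pm
                                                   (play-least x pm M⊆M′ (illegal⇒N⊆ lx))) ⟩
      suc (value G k false (play G M x))  ∎

    antitone : ∀ d → value G (suc k) d M′ ≤ value G (suc k) d M
    antitone true with x , _ , eq ← value-dominator-optimal k v∉M = begin
      value G (suc k) true M′            ≤⟨ answer x ⟩
      suc (value G k false (play G M x)) ≡⟨ sym eq ⟩
      value G (suc k) true M             ∎
    antitone false with y , ly , eq ← value-staller-optimal k v∉M′ = begin
      value G (suc k) false M′           ≡⟨ eq ⟩
      suc (value G k true (play G M′ y)) ≤⟨ s≤s (value-antitone k true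
                                                  (play-partiallyMarked M′ y) (play-monotone y M⊆M′)) ⟩
      suc (value G k true (play G M y))  ≤⟨ value-staller-≥ k v∉M (legal-antitone M⊆M′ ly) ⟩
      value G (suc k) false M            ∎

  Touches : Fin n → Fin n → Fin n → Set
  Touches y ℓ s = N[ y ] ℓ ≡ true ⊎ N[ y ] s ≡ true

  Sealed : VSet G → Fin n → Fin n → Set
  Sealed R ℓ s = ∀ y → Touches y ℓ s → N[ y ] ⊆ R

  sealed-untouched : ∀ {R ℓ s y} → Sealed R ℓ s → legal G R y ≡ true → ¬ Touches y ℓ s
  sealed-untouched sealed ly touch with v , yv , v∉R ← legal⁻ ly =
    not-¬ (sealed _ touch v yv) v∉R

  sealed-or-leak : ∀ R ℓ s →
                   Sealed R ℓ s ⊎ ∃₂ λ y w → Touches y ℓ s × N[ y ] w ≡ true × R w ≡ false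
  sealed-or-leak R ℓ s
    with all (λ y → all (λ w → not (N[ y ] ℓ ∨ N[ y ] s) ∨ (not (N[ y ] w) ∨ R w)) (allFin n))
             (allFin n) in check
  ... | true  = inj₁ λ y touch w yw →
    not∨-true⁻ (N[ y ] w)
      (not∨-true⁻ (N[ y ] ℓ ∨ N[ y ] s) (all-allFin⁻ _ (all-allFin⁻ _ check y) w) (∨-true⁺ _ touch))
      yw
  ... | false =
    let y , y-leaks    = all-allFin-false⁻ _ check
        w , leak       = all-allFin-false⁻ _ y-leaks
        touch , y-leak = not∨-false⁻ (N[ y ] ℓ ∨ N[ y ] s) leak
        yw , w∉R       = not∨-false⁻ (N[ y ] w) y-leak
    in inj₂ (y , w , ∨-true⁻ (N[ y ] ℓ) touch , yw , w∉R)

  record ExtraEdge (I R : VSet G) : Set where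
    field
      ℓ s               : Fin n
      edge              : Adj G ℓ s
      ℓ∉I               : I ℓ ≡ false
      s∉I               : I s ≡ false
      I⊆R               : I ⊆ R
      R-partiallyMarked : PartiallyMarked G R
      sealed            : Sealed R ℓ s

  extraEdge-play : ∀ {I R y} → ExtraEdge I R → legal G R y ≡ true →
                   ExtraEdge (play G I y) (play G R y)
  extraEdge-play {I} {R} {y} e ly = record
    { ℓ                 = ℓ
    ; s                 = s
    ; edge              = edge
    ; ℓ∉I               = play-false⁺ I y ℓ∉I∪N edge s∉I∪N
    ; s∉I               = play-false⁺ I y s∉I∪N (Adj-sym edge) ℓ∉I∪N
    ; I⊆R               = play-monotone y I⊆R
    ; R-partiallyMarked = play-partiallyMarked R y
    ; sealed            = λ z touch v zv → ⊆-play R y v (sealed z touch v zv)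
    }
    where
    open ExtraEdge e
    ℓ∉I∪N : (I ∪ N[ y ]) ℓ ≡ false
    ℓ∉I∪N = cong₂ _∨_ ℓ∉I (¬-not (sealed-untouched sealed ly ∘ inj₁))
    s∉I∪N : (I ∪ N[ y ]) s ≡ false
    s∉I∪N = cong₂ _∨_ s∉I (¬-not (sealed-untouched sealed ly ∘ inj₂))

  extraEdge-legal : ∀ {M p} → PartiallyMarked G M → ExtraEdge M (play G M p) → legal G M p ≡ true
  extraEdge-legal {M} {p} pm e = ¬-not λ illegal →
    not-¬ (play-least p pm (λ _ → id) (illegal⇒N⊆ illegal) ℓ ℓ∈R) ℓ∉I
    where
    open ExtraEdge e
    ℓ∈R : play G M p ℓ ≡ true
    ℓ∈R = sealed ℓ (inj₁ (x∈N[x] ℓ)) ℓ (x∈N[x] ℓ)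

  SealingMovesExist : Set
  SealingMovesExist =
    ∀ {M v} → PartiallyMarked G M → M v ≡ false → ∃ λ p → ExtraEdge M (play G M p)

  module _ (sealing : SealingMovesExist) where
    open ≤-Reasoning

    mutual
      dominatorFirst≤stallerFirst : ∀ k M → PartiallyMarked G M →
                                    value G k true M ≤ value G k false M
      dominatorFirst≤stallerFirst zero    _ _ = z≤n
      dominatorFirst≤stallerFirst (suc k) M pm with allMarked-or-unmarked M
      ... | inj₁ full rewrite value-allMarked (suc k) true full = z≤n
      ... | inj₂ (v , v∉M) with p , e ← sealing pm v∉M = begin
        value G (suc k) true M             ≤⟨ value-dominator-≤ k v∉M (extraEdge-legal pm e) ⟩
        suc (value G k false (play G M p)) ≤⟨ extraEdge-staller k e ⟩
        value G (suc k) false M            ∎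

      extraEdge-staller : ∀ k {I R} → ExtraEdge I R →
                          suc (value G k false R) ≤ value G (suc k) false I
      extraEdge-staller zero    e = value-positive 0 (ExtraEdge.ℓ∉I e) false
      extraEdge-staller (suc k) {I} {R} e with allMarked-or-unmarked R
      ... | inj₁ full rewrite value-allMarked (suc k) false full =
        value-positive (suc k) (ExtraEdge.ℓ∉I e) false
      ... | inj₂ (_ , v∉R) with y , ly , eq ← value-staller-optimal k v∉R = begin
        suc (value G (suc k) false R)           ≡⟨ cong suc eq ⟩
        suc (suc (value G k true (play G R y))) ≤⟨ s≤s (extraEdge-dominator k (extraEdge-play e ly)) ⟩
        suc (value G (suc k) true (play G I y)) ≤⟨ value-staller-≥ (suc k) ℓ∉I (legal-antitone I⊆R ly) ⟩
        value G (suc (suc k)) false I           ∎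
        where open ExtraEdge e

      extraEdge-dominator : ∀ k {I R} → ExtraEdge I R →
                            suc (value G k true R) ≤ value G (suc k) true I
      extraEdge-dominator zero            e = value-positive 0 (ExtraEdge.ℓ∉I e) true
      extraEdge-dominator (suc k) {R = R} e = extraEdge-dominator-assuming k e
        (dominatorFirst≤stallerFirst (suc k) R (ExtraEdge.R-partiallyMarked e))

      -- The theorem for R enters as an argument, not as a call under the `with' below,
      -- so that the termination checker sees the fuel decrease.
      extraEdge-dominator-assuming : ∀ k {I R} → ExtraEdge I R →
                                     value G (suc k) true R ≤ value G (suc k) false R →
                                     suc (value G (suc k) true R) ≤ value G (suc (suc k)) true I
      extraEdge-dominator-assuming k {I} {R} e R-dom≤sta with allMarked-or-unmarked R
      ... | inj₁ full rewrite value-allMarked (suc k) true full =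
        value-positive (suc k) (ExtraEdge.ℓ∉I e) true
      ... | inj₂ (_ , v∉R) with d , _ , eq ← value-dominator-optimal (suc k) (ExtraEdge.ℓ∉I e) = begin
        suc (value G (suc k) true R)             ≤⟨ s≤s (answer d) ⟩
        suc (value G (suc k) false (play G I d)) ≡⟨ sym eq ⟩
        value G (suc (suc k)) true I             ∎
        where
        open ExtraEdge e
        answer : ∀ d → value G (suc k) true R ≤ value G (suc k) false (play G I d)
        answer d with legal G R d in ld
        ... | true  = ≤-trans (value-dominator-≤ k v∉R ld) (extraEdge-staller k (extraEdge-play e ld))
        ... | false = ≤-trans R-dom≤sta (value-antitone (suc k) false R-partiallyMarked
                                           (play-least d R-partiallyMarked I⊆R (illegal⇒N⊆ ld)))

  Path : List (Fin n) → Set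
  Path vs = Unique vs × Linked (Adj G) vs

  path-length≤ : ∀ {vs} → Path vs → length vs ≤ n
  path-length≤ (unique , _) = injective⇒≤ (lookup-injective unique)

  path-tail : ∀ {a Q} → Path (a ∷ Q) → Path Q
  path-tail (_ ∷ unique , linked) = unique , Linked.tail linked

  NotHead : Fin n → List (Fin n) → Set
  NotHead b []      = ⊤
  NotHead b (c ∷ _) = b ≢ c

  module _ (forest : IsForest G) where

    adjacent∉path : ∀ {a b Q} → Path (a ∷ Q) → Adj G a b → NotHead b Q → b ∉ a ∷ Q
    adjacent∉path _ ab _ (here b≡a) = Adj-irrefl ab (sym b≡a)
    adjacent∉path {Q = _ ∷ _} _ _ b≢c (there (here b≡c)) = b≢c b≡c
    adjacent∉path {a} {b} {c ∷ _} (unique , linked) ab _ (there (there b∈Q))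
      with zs , _ , refl ← ∈-∃++ b∈Q =
      forest (b , a ∷ c ∷ zs , s≤s (s≤s z≤n) ,
              unique-rotate (a ∷ c ∷ zs) unique , Adj-sym ab ∷ linked-prefix (a ∷ c ∷ zs) linked)

    path-extend : ∀ {a b Q} → Path (a ∷ Q) → Adj G a b → NotHead b Q → Path (b ∷ a ∷ Q)
    path-extend p@(unique , linked) ab b∉head =
      ¬Any⇒All¬ _ (adjacent∉path p ab b∉head) ∷ unique , Adj-sym ab ∷ linked

    module _ {M : VSet G} where

      record FreeEdgePath : Set where
        constructor freeEdgePath
        field
          ℓ s  : Fin n
          rest : List (Fin n)
          path : Path (ℓ ∷ s ∷ rest)
          ℓ∉M  : M ℓ ≡ false
          s∉M  : M s ≡ false

      LongerThan : List (Fin n) → Set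
      LongerThan rest = Σ FreeEdgePath λ P → length rest < length (FreeEdgePath.rest P)

      pivot : Fin n → List (Fin n) → Fin n
      pivot s []      = s
      pivot _ (c ∷ _) = c

      s∈N[pivot] : ∀ {s rest} → Path (s ∷ rest) → N[ pivot s rest ] s ≡ true
      s∈N[pivot] {s} {[]}       _            = x∈N[x] s
      s∈N[pivot] {rest = _ ∷ _} (_ , sc ∷ _) = Adj⇒∈N (Adj-sym sc)

      ≢pivot⇒notHead : ∀ {s y} rest → y ≢ pivot s rest → NotHead y rest
      ≢pivot⇒notHead []      _   = tt
      ≢pivot⇒notHead (_ ∷ _) y≢c = y≢c

      prepend-free-edge : ∀ {y w u Q} → Path (y ∷ Q) → Adj G y w → NotHead w Q → Adj G w u →
                          M w ≡ false → M u ≡ false →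
                          Σ FreeEdgePath λ P → length Q ≤ length (FreeEdgePath.rest P)
      prepend-free-edge {y} {w} {u} {Q} p yw w∉head wu w∉M u∉M with u ≟ y
      ... | yes refl = freeEdgePath w u Q (path-extend p yw w∉head) w∉M u∉M , ≤-refl
      ... | no  u≢y  =
        freeEdgePath u w (y ∷ Q) (path-extend (path-extend p yw w∉head) wu u≢y) u∉M w∉M , n≤1+n _

      leak⇒longer : ∀ {ℓ s rest y w u} → Path (ℓ ∷ s ∷ rest) → M ℓ ≡ false → M s ≡ false →
                    Touches y ℓ s → N[ y ] w ≡ true → Adj G w u →
                    (M ∪ N[ pivot s rest ]) w ≡ false → (M ∪ N[ pivot s rest ]) u ≡ false →
                    LongerThan rest
      leak⇒longer {ℓ} {s} {rest} {y} {w} {u} P ℓ∉M s∉M touch yw wu w∉ u∉ = extend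
        where
        w∉M  : M w ≡ false
        w∉M  = ∨-conicalˡ (M w) _ w∉
        w∉Np : N[ pivot s rest ] w ≡ false
        w∉Np = ∨-conicalʳ (M w) _ w∉
        u∉M  : M u ≡ false
        u∉M  = ∨-conicalˡ (M u) _ u∉
        u∉Np : N[ pivot s rest ] u ≡ false
        u∉Np = ∨-conicalʳ (M u) _ u∉
        w≢s  : w ≢ s
        w≢s  = distinguishes N[ pivot s rest ] (s∈N[pivot] (path-tail P)) w∉Np
        u≢s  : u ≢ s
        u≢s  = distinguishes N[ pivot s rest ] (s∈N[pivot] (path-tail P)) u∉Np

        extend : LongerThan rest
        extend with w ≟ ℓ | adj G ℓ w in ℓw | adj G s w in sw
        ... | yes refl | _     | _     =
          freeEdgePath u w (s ∷ rest) (path-extend P wu u≢s) u∉M w∉M , ≤-refl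
        ... | no _     | true  | _     =
          freeEdgePath w ℓ (s ∷ rest) (path-extend P ℓw w≢s) w∉M ℓ∉M , ≤-refl
        ... | no _     | false | true  =
          freeEdgePath u w (s ∷ rest) (path-extend (path-extend (path-tail P) sw w∉head) wu u≢s)
                       u∉M w∉M , ≤-refl
          where
          w∉head : NotHead w rest
          w∉head = ≢pivot⇒notHead rest (distinguishes N[ pivot s rest ] (x∈N[x] (pivot s rest)) w∉Np)
        ... | no w≢ℓ   | false | false = at-distance-two touch y-adj-w
          where
          w-untouched : ¬ Touches w ℓ s
          w-untouched (inj₁ wℓ) = [ (λ a → not-¬ (Adj-sym a) ℓw) , w≢ℓ ]′ (∈N⁻ wℓ)
          w-untouched (inj₂ ws) = [ (λ a → not-¬ (Adj-sym a) sw) , w≢s ]′ (∈N⁻ ws)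

          y-adj-w : Adj G y w
          y-adj-w = [ id , (λ { refl → ⊥-elim (w-untouched touch) }) ]′ (∈N⁻ yw)

          at-distance-two : Touches y ℓ s → Adj G y w → LongerThan rest
          at-distance-two (inj₁ yℓ) yw′ with ∈N⁻ yℓ
          ... | inj₂ refl = ⊥-elim (not-¬ yw′ ℓw)
          ... | inj₁ yℓ′  = map₂ (≤-trans (n≤1+n _))
            (prepend-free-edge (path-extend P (Adj-sym yℓ′) y≢s) yw′ w≢ℓ wu w∉M u∉M)
            where
            y≢s : y ≢ s
            y≢s = ≢-sym (distinguishes (λ z → adj G z w) yw′ sw)
          at-distance-two (inj₂ ys) yw′ with ∈N⁻ ys
          ... | inj₂ refl = ⊥-elim (not-¬ yw′ sw)
          ... | inj₁ ys′  =
            prepend-free-edge (path-extend (path-tail P) (Adj-sym ys′) y∉head) yw′ w≢s wu w∉M u∉M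
            where
            y∉head : NotHead y rest
            y∉head = ≢pivot⇒notHead rest
              (≢-sym (distinguishes (λ z → N[ z ] w) (Adj⇒∈N yw′) w∉Np))

      freeEdgePath⇒sealingMove : ∀ m (P : FreeEdgePath) → n ≤ m + length (FreeEdgePath.rest P) →
                                 ∃ λ p → ExtraEdge M (play G M p)
      freeEdgePath⇒sealingMove zero (freeEdgePath _ _ _ path _ _) n≤rest =
        ⊥-elim (≤⇒≯ n≤rest (≤-trans (n≤1+n _) (path-length≤ path)))
      freeEdgePath⇒sealingMove (suc m) (freeEdgePath ℓ s rest path ℓ∉M s∉M) bound
        with sealed-or-leak (play G M (pivot s rest)) ℓ s
      ... | inj₁ sealed = pivot s rest , record
        { ℓ                 = ℓ
        ; s                 = s
        ; edge              = Linked.head (proj₂ path)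
        ; ℓ∉I               = ℓ∉M
        ; s∉I               = s∉M
        ; I⊆R               = ⊆-play M (pivot s rest)
        ; R-partiallyMarked = play-partiallyMarked M (pivot s rest)
        ; sealed            = sealed
        }
      ... | inj₂ (y , w , touch , yw , w∉R)
        with w∉ , u , wu , u∉ ← play-false⁻ M (pivot s rest) w∉R
        with P′ , longer ← leak⇒longer path ℓ∉M s∉M touch yw wu w∉ u∉ =
        freeEdgePath⇒sealingMove m P′
          (≤-trans bound (≤-trans (≤-reflexive (sym (+-suc m _))) (+-monoʳ-≤ m longer)))

    forest-sealingMovesExist : SealingMovesExist
    forest-sealingMovesExist {M} {v} pm v∉M with u , vu , u∉M ← pm v v∉M =
      freeEdgePath⇒sealingMove n (freeEdgePath v u [] edge-path v∉M u∉M) (m≤m+n n 0)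
      where
      edge-path : Path (v ∷ u ∷ [])
      edge-path = (Adj-irrefl vu ∷ []) ∷ [] ∷ [] , vu ∷ [-]

theorem4p2 : (n : ℕ) (F : Graph n) → IsForest F →
    (A : VSet F) → PartiallyMarked F A → ιg F A ≤ ιg' F A
theorem4p2 n F forest A pm = dominatorFirst≤stallerFirst F (forest-sealingMovesExist F forest) n A pm
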